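{- Let $0<q<1$, let $A_q(t)=\sum_{n\ge0}A_{n,q}\frac{t^n}{[n]_q!}$ be a real formal power series with $A_{0,q}\ne0$, define polynomials $A_{n,q}(x)$ by $A_q(t)e_q(tx)=\sum_{n\ge0}A_{n,q}(x)\frac{t^n}{[n]_q!}$, and let $B_{n,q}$ be defined by $\frac{1}{A_q(t)}=\sum_{n\ge0}B_{n,q}\frac{t^n}{[n]_q!}$. The following are equivalent: (a) $A_{n,q}(-x)=(-1)^nA_{n,q}(x)$ for all $n\ge0$; (b) $B_{2n+1,q}=0$ for all $n\ge0$.
   Context: $[n]_q=\frac{1-q^n}{1-q}$, $[n]_q!=[1]_q\cdots[n]_q$ with $[0]_q!=1$, and $e_q(z)=\sum_{n\ge0}\frac{z^n}{[n]_q!}$. -}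

module Defs where

open import Level using (0ℓ)
import Data.Nat
open import Data.Nat using (ℕ; zero; suc; _∸_)
open import Data.Product using (Σ; _×_; _,_)
open import Relation.Nullary using (¬_)
open import Data.Sum using (_⊎_)
open import Algebra.Structures using (IsCommutativeRing)

-- The inverse is total (as in Lean),
-- with the inverse law only for nonzero elements.
record RealNumbers : Set₁ where
  infixl 7 _*_
  infixl 6 _+_
  infix  4 _≈_ _<_
  field
    Carrier : Set
    _≈_     : Carrier → Carrier → Set
    _+_ _*_ : Carrier → Carrier → Carrier
    -_      : Carrier → Carrier
    0# 1#   : Carrier
    isCommutativeRing : IsCommutativeRing _≈_ _+_ _*_ -_ 0# 1#
    _⁻¹     : Carrier → Carrier
    ⁻¹-inverse : ∀ x → ¬ (x ≈ 0#) → x * (x ⁻¹) ≈ 1#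
    0≉1     : ¬ (0# ≈ 1#)
    _<_        : Carrier → Carrier → Set
    <-irrefl   : ∀ {x y} → x ≈ y → ¬ (x < y)
    <-trans    : ∀ {x y z} → x < y → y < z → x < z
    <-trichotomy : ∀ x y → (x < y) ⊎ ((x ≈ y) ⊎ (y < x))
    <-resp-≈   : ∀ {x x' y y'} → x ≈ x' → y ≈ y' → x < y → x' < y'
    +-mono-<   : ∀ {x y} z → x < y → x + z < y + z
    *-pos      : ∀ {x y} → 0# < x → 0# < y → 0# < x * y
    completeness : (S : Carrier → Set) → Σ Carrier S →
                   Σ Carrier (λ b → ∀ s → S s → ¬ (b < s)) →
                   Σ Carrier (λ u → (∀ s → S s → ¬ (u < s)) ×
                                   (∀ b → (∀ s → S s → ¬ (b < s)) → ¬ (b < u)))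
  open IsCommutativeRing isCommutativeRing public

module RealDefs (ℝ : RealNumbers) where
  open RealNumbers ℝ using (Carrier; _≈_; _+_; _*_; -_; 0#; 1#; _⁻¹)

  pow : Carrier → ℕ → Carrier
  pow x zero    = 1#
  pow x (suc n) = pow x n * x

  sumTo : ℕ → (ℕ → Carrier) → Carrier
  sumTo zero    f = f zero
  sumTo (suc n) f = sumTo n f + f (suc n)

  qInt : Carrier → ℕ → Carrier
  qInt q n = (1# + - pow q n) * ((1# + - q) ⁻¹)

  qFact : Carrier → ℕ → Carrier
  qFact q zero    = 1#
  qFact q (suc n) = qFact q n * qInt q (suc n)

  -- A formal power series in t is given by its sequence of (ordinary)
  -- coefficients ℕ → ℝ.  Σ_n c_n t^n/[n]_q!  has ordinary coefficients:
  qExpSeries : Carrier → (ℕ → Carrier) → (ℕ → Carrier)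
  qExpSeries q c n = c n * (qFact q n ⁻¹)

  seriesMul : (ℕ → Carrier) → (ℕ → Carrier) → (ℕ → Carrier)
  seriesMul f g n = sumTo n (λ k → f k * g (n ∸ k))

  eqSeries : Carrier → Carrier → (ℕ → Carrier)
  eqSeries q x = qExpSeries q (λ n → pow x n)

  -- A_{n,q}(x): defined by A_q(t) e_q(tx) = Σ_n A_{n,q}(x) t^n/[n]_q!,
  -- i.e. A_{n,q}(x) = [n]_q! · [t^n](A_q(t) e_q(tx)).
  -- Here A n stands for A_{n,q}.
  Apoly : Carrier → (ℕ → Carrier) → ℕ → Carrier → Carrier
  Apoly q A n x = qFact q n * seriesMul (qExpSeries q A) (eqSeries q x) n

  oneSeries : ℕ → Carrier
  oneSeries zero    = 1#
  oneSeries (suc n) = 0#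

  -- 1/A_q(t) = Σ_n B n t^n/[n]_q!  means  A_q(t) · Σ_n B n t^n/[n]_q! = 1
  -- (as formal power series; the inverse exists and is unique since A 0 ≠ 0).
  IsReciprocal : Carrier → (ℕ → Carrier) → (ℕ → Carrier) → Set
  IsReciprocal q A B =
    ∀ n → seriesMul (qExpSeries q A) (qExpSeries q B) n ≈ oneSeries n

  ConditionA : Carrier → (ℕ → Carrier) → Set
  ConditionA q A = ∀ n x → Apoly q A n (- x) ≈ pow (- 1#) n * Apoly q A n x

  ConditionB : (ℕ → Carrier) → Set
  ConditionB B = ∀ n → B (suc (n Data.Nat.+ n)) ≈ 0#

{-# OPTIONS --safe #-}
module Submission where

-- Write a(t) = A_q(t) and b(t) = 1/A_q(t) as ordinary power series.  The substitution
-- t ↦ -t is a ring endomorphism of power series; call a series even when it is fixed by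
-- it.  Since A_{n,q}(x) is [n]_q! times the n-th coefficient of a(t) e_q(tx), and
-- e_q(-tx) is e_q(tx) with t replaced by -t, condition (a) says exactly that a is even
-- (take x = 0 for the converse).  The reciprocal of an even series is even, by
-- uniqueness of reciprocals, and since 2 ≠ 0 an even series is one whose odd
-- coefficients vanish, which for b is condition (b).  Dividing by [n]_q! is harmless because 0 < q < 1.

open import Defs
open import Data.Nat using (ℕ)
open import Data.Product using (_×_)
open import Relation.Nullary using (¬_)
open import Function.Bundles using (_⇔_)

open import Level using (0ℓ)
import Data.Nat as ℕ
open import Data.Nat using (zero; suc; _∸_; _≤_; z≤n; s≤s)
open import Data.Nat.Properties using (≤-refl; ≤-trans; m≤n⇒m≤1+n; m∸n≤m; m∸[m∸n]≡n; m+[n∸m]≡n; +-suc)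
import Relation.Binary.PropositionalEquality as ≡
open import Algebra.Bundles using (CommutativeRing)
open import Function.Bundles using (mk⇔)
open import Function.Properties.Equivalence using (⇔-setoid)

data Parity : ℕ → Set where
  even : ∀ k → Parity (k ℕ.+ k)
  odd  : ∀ k → Parity (suc (k ℕ.+ k))

parity : ∀ n → Parity n
parity zero = even 0
parity (suc n) with parity n
... | even k = odd k
... | odd k  = ≡.subst Parity (≡.cong suc (+-suc k k)) (even (suc k))

module PowerSeries (ℝ : RealNumbers) where
  open RealNumbers ℝ
  open RealDefs ℝ
  open import Relation.Binary.Reasoning.Setoid setoid

  commutativeRing : CommutativeRing 0ℓ 0ℓ
  commutativeRing = record { isCommutativeRing = isCommutativeRing }

  open CommutativeRing commutativeRing using (ring; +-group; *-commutativeSemigroup)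
  open import Algebra.Properties.Ring ring using (-1*x≈-x; -‿involutive; -0#≈0#; x[y-z]≈xy-xz)
  open import Algebra.Properties.Group +-group using () renaming (∙-cancelʳ to +-cancelʳ)
  open import Algebra.Properties.CommutativeSemigroup *-commutativeSemigroup
    using (interchange; x∙yz≈y∙xz; xy∙z≈xz∙y)

  *-cancelˡ-unit : ∀ {c x y z} → c * x ≈ 1# → x * y ≈ x * z → y ≈ z
  *-cancelˡ-unit {c} {x} {y} {z} cx≈1 xy≈xz = begin
    y              ≈⟨ *-identityˡ y ⟨
    1# * y         ≈⟨ *-congʳ cx≈1 ⟨
    (c * x) * y    ≈⟨ *-assoc c x y ⟩
    c * (x * y)    ≈⟨ *-congˡ xy≈xz ⟩
    c * (x * z)    ≈⟨ *-assoc c x z ⟨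
    (c * x) * z    ≈⟨ *-congʳ cx≈1 ⟩
    1# * z         ≈⟨ *-identityˡ z ⟩
    z              ∎

  *-cancelˡ-nonzero : ∀ {x y z} → ¬ x ≈ 0# → x * y ≈ x * z → y ≈ z
  *-cancelˡ-nonzero {x} x≉0 = *-cancelˡ-unit (trans (*-comm (x ⁻¹) x) (⁻¹-inverse x x≉0))

  *-cancelʳ-nonzero : ∀ {x y z} → ¬ x ≈ 0# → y * x ≈ z * x → y ≈ z
  *-cancelʳ-nonzero {x} {y} {z} x≉0 yx≈zx =
    *-cancelˡ-nonzero x≉0 (trans (*-comm x y) (trans yx≈zx (*-comm z x)))

  *-nonzero : ∀ {x y} → ¬ x ≈ 0# → ¬ y ≈ 0# → ¬ x * y ≈ 0#
  *-nonzero {x} x≉0 y≉0 xy≈0 = y≉0 (*-cancelˡ-nonzero x≉0 (trans xy≈0 (sym (zeroʳ x))))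

  ⁻¹-nonzero : ∀ {x} → ¬ x ≈ 0# → ¬ x ⁻¹ ≈ 0#
  ⁻¹-nonzero {x} x≉0 x⁻¹≈0 = 0≉1 (trans (sym (trans (*-congˡ x⁻¹≈0) (zeroʳ x))) (⁻¹-inverse x x≉0))

  x≈-x⇒x≈0 : ¬ 1# + 1# ≈ 0# → ∀ {x} → x ≈ - x → x ≈ 0#
  x≈-x⇒x≈0 2≉0 {x} x≈-x = *-cancelˡ-nonzero 2≉0 (begin
    (1# + 1#) * x        ≈⟨ distribʳ x 1# 1# ⟩
    1# * x + 1# * x      ≈⟨ +-cong (*-identityˡ x) (*-identityˡ x) ⟩
    x + x                ≈⟨ +-congˡ x≈-x ⟩
    x + - x              ≈⟨ -‿inverseʳ x ⟩
    0#                   ≈⟨ zeroʳ (1# + 1#) ⟨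
    (1# + 1#) * 0#       ∎)

  <⇒≉ : ∀ {x y} → x < y → ¬ y ≈ x
  <⇒≉ x<y y≈x = <-irrefl (sym y≈x) x<y

  +-pos : ∀ {x y} → 0# < x → 0# < y → 0# < x + y
  +-pos {x} {y} 0<x 0<y = <-trans (<-resp-≈ refl (sym (+-identityˡ y)) 0<y) (+-mono-< y 0<x)

  x<y⇒0<y-x : ∀ {x y} → x < y → 0# < y + - x
  x<y⇒0<y-x {x} x<y = <-resp-≈ (-‿inverseʳ x) refl (+-mono-< (- x) x<y)

  0<y-x⇒x<y : ∀ {x y} → 0# < y + - x → x < y
  0<y-x⇒x<y {x} {y} 0<y-x = <-resp-≈ (+-identityˡ x) y-x+x≈y (+-mono-< x 0<y-x)
    where
    y-x+x≈y : (y + - x) + x ≈ y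
    y-x+x≈y = trans (+-assoc y (- x) x) (trans (+-congˡ (-‿inverseˡ x)) (+-identityʳ y))

  x*y<x : ∀ {x y} → 0# < x → y < 1# → x * y < x
  x*y<x {x} {y} 0<x y<1 = 0<y-x⇒x<y (<-resp-≈ refl x[1-y]≈x-xy (*-pos 0<x (x<y⇒0<y-x y<1)))
    where
    x[1-y]≈x-xy : x * (1# + - y) ≈ x + - (x * y)
    x[1-y]≈x-xy = trans (x[y-z]≈xy-xz x 1# y) (+-congʳ (*-identityʳ x))

  pow-cong : ∀ {x y} → x ≈ y → ∀ n → pow x n ≈ pow y n
  pow-cong x≈y zero    = refl
  pow-cong x≈y (suc n) = *-cong (pow-cong x≈y n) x≈y

  pow-+ : ∀ x m n → pow x (m ℕ.+ n) ≈ pow x m * pow x n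
  pow-+ x zero    n = sym (*-identityˡ (pow x n))
  pow-+ x (suc m) n = trans (*-congʳ (pow-+ x m n)) (xy∙z≈xz∙y (pow x m) (pow x n) x)

  pow-distribʳ-* : ∀ x y n → pow (x * y) n ≈ pow x n * pow y n
  pow-distribʳ-* x y zero    = sym (*-identityˡ 1#)
  pow-distribʳ-* x y (suc n) = trans (*-congʳ (pow-distribʳ-* x y n)) (interchange (pow x n) (pow y n) x y)

  pow-1# : ∀ n → pow 1# n ≈ 1#
  pow-1# zero    = refl
  pow-1# (suc n) = trans (*-identityʳ (pow 1# n)) (pow-1# n)

  pow-pos : ∀ {x} → 0# < x → ∀ n → 0# < pow x (suc n)
  pow-pos {x} 0<x zero    = <-resp-≈ refl (sym (*-identityˡ x)) 0<x
  pow-pos     0<x (suc n) = *-pos (pow-pos 0<x n) 0<x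

  pow-<1 : ∀ {q} → 0# < q → q < 1# → ∀ n → pow q (suc n) < 1#
  pow-<1 {q} 0<q q<1 zero    = <-resp-≈ (sym (*-identityˡ q)) refl q<1
  pow-<1 {q} 0<q q<1 (suc n) = <-trans (x*y<x (pow-pos 0<q n) q<1) (pow-<1 0<q q<1 n)

  pow-−1-even : ∀ k → pow (- 1#) (k ℕ.+ k) ≈ 1#
  pow-−1-even k = begin
    pow (- 1#) (k ℕ.+ k)              ≈⟨ pow-+ (- 1#) k k ⟩
    pow (- 1#) k * pow (- 1#) k       ≈⟨ pow-distribʳ-* (- 1#) (- 1#) k ⟨
    pow (- 1# * - 1#) k               ≈⟨ pow-cong (trans (-1*x≈-x (- 1#)) (-‿involutive 1#)) k ⟩
    pow 1# k                          ≈⟨ pow-1# k ⟩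
    1#                                ∎

  pow-−1-odd : ∀ k → pow (- 1#) (suc (k ℕ.+ k)) ≈ - 1#
  pow-−1-odd k = trans (*-congʳ (pow-−1-even k)) (*-identityˡ (- 1#))

  sumTo-cong : ∀ n {f g} → (∀ k → k ≤ n → f k ≈ g k) → sumTo n f ≈ sumTo n g
  sumTo-cong zero    f≈g = f≈g 0 z≤n
  sumTo-cong (suc n) f≈g =
    +-cong (sumTo-cong n (λ k k≤n → f≈g k (m≤n⇒m≤1+n k≤n))) (f≈g (suc n) ≤-refl)

  sumTo-zero : ∀ n {f} → (∀ k → f k ≈ 0#) → sumTo n f ≈ 0#
  sumTo-zero zero    f≈0 = f≈0 0
  sumTo-zero (suc n) f≈0 = trans (+-cong (sumTo-zero n f≈0) (f≈0 (suc n))) (+-identityʳ 0#)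

  *-distribˡ-sumTo : ∀ c n f → c * sumTo n f ≈ sumTo n (λ k → c * f k)
  *-distribˡ-sumTo c zero    f = refl
  *-distribˡ-sumTo c (suc n) f = trans (distribˡ c _ _) (+-congʳ (*-distribˡ-sumTo c n f))

  sumTo-head : ∀ n f → sumTo (suc n) f ≈ f 0 + sumTo n (λ k → f (suc k))
  sumTo-head zero    f = refl
  sumTo-head (suc n) f = trans (+-congʳ (sumTo-head n f)) (+-assoc (f 0) _ _)

  sumTo-reverse : ∀ n f → sumTo n f ≈ sumTo n (λ k → f (n ∸ k))
  sumTo-reverse zero    f = refl
  sumTo-reverse (suc n) f = begin
    sumTo n f + f (suc n)                           ≈⟨ +-congʳ (sumTo-reverse n f) ⟩
    sumTo n (λ k → f (n ∸ k)) + f (suc n)           ≈⟨ +-comm _ _ ⟩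
    f (suc n) + sumTo n (λ k → f (n ∸ k))           ≈⟨ sumTo-head n (λ k → f (suc n ∸ k)) ⟨
    sumTo (suc n) (λ k → f (suc n ∸ k))             ∎

  seriesMul-cong : ∀ {f f′ g g′} → (∀ k → f k ≈ f′ k) → (∀ k → g k ≈ g′ k) →
                   ∀ n → seriesMul f g n ≈ seriesMul f′ g′ n
  seriesMul-cong f≈f′ g≈g′ n = sumTo-cong n (λ k _ → *-cong (f≈f′ k) (g≈g′ (n ∸ k)))

  seriesMul-comm : ∀ f g n → seriesMul f g n ≈ seriesMul g f n
  seriesMul-comm f g n = begin
    sumTo n (λ k → f k * g (n ∸ k))                 ≈⟨ sumTo-reverse n _ ⟩
    sumTo n (λ k → f (n ∸ k) * g (n ∸ (n ∸ k)))     ≈⟨ sumTo-cong n swap ⟩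
    sumTo n (λ k → g k * f (n ∸ k))                 ∎
    where
    swap : ∀ k → k ≤ n → f (n ∸ k) * g (n ∸ (n ∸ k)) ≈ g k * f (n ∸ k)
    swap k k≤n rewrite m∸[m∸n]≡n k≤n = *-comm (f (n ∸ k)) (g k)

  seriesMul-identityˡ : ∀ {e} → (∀ k → e k ≈ oneSeries k) → ∀ f n → seriesMul e f n ≈ f n
  seriesMul-identityˡ e≈1 f zero    = trans (*-congʳ (e≈1 0)) (*-identityˡ (f 0))
  seriesMul-identityˡ {e} e≈1 f (suc n) = begin
    seriesMul e f (suc n)                               ≈⟨ sumTo-head n _ ⟩
    e 0 * f (suc n) + sumTo n (λ k → e (suc k) * f (n ∸ k))
      ≈⟨ +-cong (*-congʳ (e≈1 0)) (sumTo-zero n (λ k → trans (*-congʳ (e≈1 (suc k))) (zeroˡ _))) ⟩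
    1# * f (suc n) + 0#                                 ≈⟨ +-identityʳ _ ⟩
    1# * f (suc n)                                      ≈⟨ *-identityˡ _ ⟩
    f (suc n)                                           ∎

  seriesMul-cancelˡ : ∀ {c f g h} → c * f 0 ≈ 1# →
                      (∀ n → seriesMul f g n ≈ seriesMul f h n) → ∀ n → g n ≈ h n
  seriesMul-cancelˡ {c} {f} {g} {h} cf₀≈1 fg≈fh n = agreeUpTo n n ≤-refl
    where
    agreeUpTo : ∀ n k → k ≤ n → g k ≈ h k
    agreeUpTo _       zero    _         = *-cancelˡ-unit cf₀≈1 (fg≈fh 0)
    agreeUpTo (suc n) (suc k) (s≤s k≤n) = *-cancelˡ-unit cf₀≈1 (+-cancelʳ tail _ _ (begin
      f 0 * g (suc k) + tail                            ≈⟨ sumTo-head k _ ⟨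
      seriesMul f g (suc k)                             ≈⟨ fg≈fh (suc k) ⟩
      seriesMul f h (suc k)                             ≈⟨ sumTo-head k _ ⟩
      f 0 * h (suc k) + sumTo k (λ j → f (suc j) * h (k ∸ j))
        ≈⟨ +-congˡ (sumTo-cong k (λ j _ → *-congˡ (sym (agreeUpTo n (k ∸ j) (≤-trans (m∸n≤m k j) k≤n))))) ⟩
      f 0 * h (suc k) + tail                            ∎))
      where
      tail : Carrier
      tail = sumTo k (λ j → f (suc j) * g (k ∸ j))

  -- scale c f is the series f(c t).
  scale : Carrier → (ℕ → Carrier) → ℕ → Carrier
  scale c f n = pow c n * f n

  scale-seriesMul : ∀ c f g n → scale c (seriesMul f g) n ≈ seriesMul (scale c f) (scale c g) n
  scale-seriesMul c f g n = begin
    pow c n * sumTo n (λ k → f k * g (n ∸ k))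
      ≈⟨ *-distribˡ-sumTo (pow c n) n _ ⟩
    sumTo n (λ k → pow c n * (f k * g (n ∸ k)))
      ≈⟨ sumTo-cong n split ⟩
    sumTo n (λ k → (pow c k * f k) * (pow c (n ∸ k) * g (n ∸ k)))  ∎
    where
    split : ∀ k → k ≤ n → pow c n * (f k * g (n ∸ k)) ≈ (pow c k * f k) * (pow c (n ∸ k) * g (n ∸ k))
    split k k≤n = begin
      pow c n * (f k * g (n ∸ k))
        ≈⟨ *-congʳ (≡.subst (λ m → pow c m ≈ pow c k * pow c (n ∸ k)) (m+[n∸m]≡n k≤n) (pow-+ c k (n ∸ k))) ⟩
      (pow c k * pow c (n ∸ k)) * (f k * g (n ∸ k))
        ≈⟨ interchange (pow c k) (pow c (n ∸ k)) (f k) (g (n ∸ k)) ⟩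
      (pow c k * f k) * (pow c (n ∸ k) * g (n ∸ k))  ∎

  scale-oneSeries : ∀ c n → scale c oneSeries n ≈ oneSeries n
  scale-oneSeries c zero    = *-identityʳ 1#
  scale-oneSeries c (suc n) = zeroʳ (pow c (suc n))

  IsEven : (ℕ → Carrier) → Set
  IsEven f = ∀ n → scale (- 1#) f n ≈ f n

  isEven⇔conditionB : ¬ 1# + 1# ≈ 0# → ∀ {f} → IsEven f ⇔ ConditionB f
  isEven⇔conditionB 2≉0 {f} = mk⇔ oddVanish isEven
    where
    oddVanish : IsEven f → ConditionB f
    oddVanish f-even k = x≈-x⇒x≈0 2≉0 (begin
      f (suc (k ℕ.+ k))                       ≈⟨ f-even (suc (k ℕ.+ k)) ⟨
      pow (- 1#) (suc (k ℕ.+ k)) * f (suc (k ℕ.+ k))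
                                              ≈⟨ *-congʳ (pow-−1-odd k) ⟩
      - 1# * f (suc (k ℕ.+ k))                ≈⟨ -1*x≈-x _ ⟩
      - f (suc (k ℕ.+ k))                     ∎)
    isEvenAt : ConditionB f → ∀ {n} → Parity n → scale (- 1#) f n ≈ f n
    isEvenAt _     (even k) = trans (*-congʳ (pow-−1-even k)) (*-identityˡ _)
    isEvenAt f-odd (odd k)  = trans (*-congˡ (f-odd k)) (trans (zeroʳ _) (sym (f-odd k)))
    isEven : ConditionB f → IsEven f
    isEven f-odd n = isEvenAt f-odd (parity n)

  -- f(t) g(-t) = f(-t) g(-t) = 1 = f(t) g(t), and f(t) can be cancelled.
  reciprocal-isEven : ∀ {f g} → (∀ n → seriesMul f g n ≈ oneSeries n) → IsEven f → IsEven g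
  reciprocal-isEven {f} {g} fg≈1 f-even = seriesMul-cancelˡ g₀f₀≈1 fg′≈fg
    where
    g₀f₀≈1 : g 0 * f 0 ≈ 1#
    g₀f₀≈1 = trans (*-comm (g 0) (f 0)) (fg≈1 0)
    fg′≈fg : ∀ n → seriesMul f (scale (- 1#) g) n ≈ seriesMul f g n
    fg′≈fg n = begin
      seriesMul f (scale (- 1#) g) n
        ≈⟨ seriesMul-cong (λ k → sym (f-even k)) (λ k → refl {scale (- 1#) g k}) n ⟩
      seriesMul (scale (- 1#) f) (scale (- 1#) g) n     ≈⟨ scale-seriesMul (- 1#) f g n ⟨
      scale (- 1#) (seriesMul f g) n                    ≈⟨ *-congˡ (fg≈1 n) ⟩
      scale (- 1#) oneSeries n                          ≈⟨ scale-oneSeries (- 1#) n ⟩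
      oneSeries n                                       ≈⟨ fg≈1 n ⟨
      seriesMul f g n                                   ∎

  reciprocal-isEven⇔ : ∀ {f g} → (∀ n → seriesMul f g n ≈ oneSeries n) → IsEven f ⇔ IsEven g
  reciprocal-isEven⇔ {f} {g} fg≈1 =
    mk⇔ (reciprocal-isEven fg≈1) (reciprocal-isEven (λ n → trans (seriesMul-comm g f n) (fg≈1 n)))

  qFact-nonzero : ∀ {q} → 0# < q → q < 1# → ∀ n → ¬ qFact q n ≈ 0#
  qFact-nonzero 0<q q<1 zero    = <⇒≉ (<-trans 0<q q<1)
  qFact-nonzero 0<q q<1 (suc n) =
    *-nonzero (qFact-nonzero 0<q q<1 n)
      (*-nonzero (<⇒≉ (x<y⇒0<y-x (pow-<1 0<q q<1 n))) (⁻¹-nonzero (<⇒≉ (x<y⇒0<y-x q<1))))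

  module _ {q : Carrier} (qFact≉0 : ∀ n → ¬ qFact q n ≈ 0#) where

    qExpSeries-isEven⇔ : ∀ {A} → IsEven (qExpSeries q A) ⇔ IsEven A
    qExpSeries-isEven⇔ {A} = mk⇔
      (λ a-even n → *-cancelʳ-nonzero (⁻¹-nonzero (qFact≉0 n)) (trans (*-assoc _ _ _) (a-even n)))
      (λ A-even n → trans (sym (*-assoc _ _ _)) (*-congʳ (A-even n)))

    eqSeries-neg : ∀ x n → eqSeries q (- x) n ≈ scale (- 1#) (eqSeries q x) n
    eqSeries-neg x n = begin
      pow (- x) n * qFact q n ⁻¹                  ≈⟨ *-congʳ (pow-cong (sym (-1*x≈-x x)) n) ⟩
      pow (- 1# * x) n * qFact q n ⁻¹             ≈⟨ *-congʳ (pow-distribʳ-* (- 1#) x n) ⟩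
      (pow (- 1#) n * pow x n) * qFact q n ⁻¹     ≈⟨ *-assoc _ _ _ ⟩
      pow (- 1#) n * (pow x n * qFact q n ⁻¹)     ∎

    eqSeries-zero : ∀ {y} → y ≈ 0# → ∀ n → eqSeries q y n ≈ oneSeries n
    eqSeries-zero y≈0 zero    = ⁻¹-inverse 1# (λ 1≈0 → 0≉1 (sym 1≈0))
    eqSeries-zero y≈0 (suc n) = trans (*-congʳ (trans (*-congˡ y≈0) (zeroʳ _))) (zeroˡ _)

    conditionA⇔isEven : ∀ {A} → ConditionA q A ⇔ IsEven (qExpSeries q A)
    conditionA⇔isEven {A} = mk⇔ isEven symmetric
      where
      a : ℕ → Carrier
      a = qExpSeries q A
      Apoly-at-zero : ∀ n {y} → y ≈ 0# → Apoly q A n y ≈ qFact q n * a n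
      Apoly-at-zero n y≈0 = *-congˡ (trans (seriesMul-comm a _ n) (seriesMul-identityˡ (eqSeries-zero y≈0) a n))
      isEven : ConditionA q A → IsEven a
      isEven condA n = sym (*-cancelˡ-nonzero (qFact≉0 n) (begin
        qFact q n * a n                           ≈⟨ Apoly-at-zero n -0#≈0# ⟨
        Apoly q A n (- 0#)                        ≈⟨ condA n 0# ⟩
        pow (- 1#) n * Apoly q A n 0#             ≈⟨ *-congˡ (Apoly-at-zero n refl) ⟩
        pow (- 1#) n * (qFact q n * a n)          ≈⟨ x∙yz≈y∙xz _ _ _ ⟩
        qFact q n * scale (- 1#) a n              ∎))
      symmetric : IsEven a → ConditionA q A
      symmetric a-even n x = begin
        qFact q n * seriesMul a (eqSeries q (- x)) n
          ≈⟨ *-congˡ (seriesMul-cong (λ k → sym (a-even k)) (eqSeries-neg x) n) ⟩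
        qFact q n * seriesMul (scale (- 1#) a) (scale (- 1#) (eqSeries q x)) n
          ≈⟨ *-congˡ (scale-seriesMul (- 1#) a (eqSeries q x) n) ⟨
        qFact q n * (pow (- 1#) n * seriesMul a (eqSeries q x) n)
          ≈⟨ x∙yz≈y∙xz _ _ _ ⟩
        pow (- 1#) n * Apoly q A n x              ∎

open RealNumbers using (Carrier; _≈_; _<_; 0#; 1#)
open RealDefs using (IsReciprocal; ConditionA; ConditionB)

mainTheorem13 : (ℝ : RealNumbers) (q : Carrier ℝ) → _<_ ℝ (0# ℝ) q → _<_ ℝ q (1# ℝ) →
    (A B : ℕ → Carrier ℝ) → ¬ (_≈_ ℝ (A 0) (0# ℝ)) → IsReciprocal ℝ q A B →
    ConditionA ℝ q A ⇔ ConditionB ℝ B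
mainTheorem13 ℝ q 0<q q<1 A B _ reciprocal = begin
  ConditionA ℝ q A                         ≈⟨ conditionA⇔isEven qFact≉0 ⟩
  IsEven (RealDefs.qExpSeries ℝ q A)       ≈⟨ reciprocal-isEven⇔ reciprocal ⟩
  IsEven (RealDefs.qExpSeries ℝ q B)       ≈⟨ qExpSeries-isEven⇔ qFact≉0 ⟩
  IsEven B                                 ≈⟨ isEven⇔conditionB 2≉0 ⟩
  ConditionB ℝ B                           ∎
  where
  open PowerSeries ℝ
  open import Relation.Binary.Reasoning.Setoid (⇔-setoid 0ℓ)
  qFact≉0 : ∀ n → ¬ _≈_ ℝ (RealDefs.qFact ℝ q n) (0# ℝ)
  qFact≉0 = qFact-nonzero 0<q q<1
  0<1 : _<_ ℝ (0# ℝ) (1# ℝ)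
  0<1 = RealNumbers.<-trans ℝ 0<q q<1
  2≉0 : ¬ _≈_ ℝ (RealNumbers._+_ ℝ (1# ℝ) (1# ℝ)) (0# ℝ)
  2≉0 = <⇒≉ (+-pos 0<1 0<1)
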